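{- For every $n\ge1$, the number of integer sequences $e=(e_1,\dots,e_n)$ with $0\le e_i<i$ for all $i$ such that there are no indices $i<j<k$ with $e_i\le e_j$, $e_j>e_k$ and $e_i\ne e_k$ equals $C_{n+1}-\sum_{i=1}^n C_i$, where $C_m=\frac{1}{m+1}\binom{2m}{m}$. -}

module Defs where

open import Data.Nat using (ℕ; zero; suc; _+_; _∸_; _≤_; _<_; _/_; _≤?_; _<?_; _≟_)
open import Data.Nat.Combinatorics using (_C_)
open import Data.List using (List; []; _∷_; _++_; map; concatMap; length; filter; upTo; sum; lookup; applyUpTo)
open import Data.Fin using (Fin; toℕ)
open import Data.Product using (Σ; ∃; _×_; _,_)
open import Relation.Nullary using (¬_)
open import Relation.Binary.PropositionalEquality using (_≡_)

catalan : ℕ → ℕ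
catalan m = ((m + m) C m) / suc m

catalanSum : ℕ → ℕ
catalanSum zero    = 0
catalanSum (suc n) = catalanSum n + catalan (suc n)

-- An integer sequence e = (e_1,...,e_n) is represented as a list of
-- naturals of length n (entry e_i is at 0-based position i-1).
IsInversionSeq : ℕ → List ℕ → Set
IsInversionSeq n e =
  Σ (length e ≡ n) λ _ → (p : Fin (length e)) → lookup e p < suc (toℕ p)

HasPattern : List ℕ → Set
HasPattern e = ∃ λ (i : Fin (length e)) → ∃ λ (j : Fin (length e)) → ∃ λ (k : Fin (length e)) →
  (toℕ i < toℕ j) × (toℕ j < toℕ k) ×
  (lookup e i ≤ lookup e j) × (lookup e k < lookup e j) × ¬ (lookup e i ≡ lookup e k)

Avoids : List ℕ → Set
Avoids e = ¬ HasPattern e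

-- An inversion sequence has e₁ = 0, and for such sequences avoiding the pattern amounts to two
-- conditions: the positive entries weakly increase (else 0, eᵢ, eⱼ with eᵢ > eⱼ > 0 is an
-- occurrence), and every entry preceding a positive entry that is later followed by a zero is
-- itself zero. So an avoider is either 0ᵃ or 0ᵃ y 0ᵇ z₁ … z_c with 0 < y ≤ z₁ ≤ … ≤ z_c, subject
-- to eᵢ < i. Choosing the entries from left to right enumerates these sequences without
-- repetition. Weakly increasing runs of length k whose first entry has d admissible values are
-- counted by the ballot number B(d, k) = C(2k+d-1, k) - C(2k+d-1, k-1); in particular
-- B(1, m) = C_m, and summing over the shapes telescopes to C_{n+1} - (C_1 + … + C_n).
module Submission where

import Algebra.Properties.CommutativeSemigroup as CommutativeSemigroupProperties
open import Data.Empty using (⊥-elim)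
open import Data.Fin using (Fin; zero; suc; toℕ)
open import Data.List using (List; []; _∷_; _++_; map; [_]; length; lookup)
open import Data.List.Properties using (length-++; length-map; ∷-injectiveʳ)
open import Data.List.Membership.Propositional using (_∈_; _∉_)
open import Data.List.Membership.Propositional.Properties
  using (∈-map⁺; ∈-++⁺ˡ; ∈-++⁺ʳ; ∈-++⁻; map∷-decomp∈; map∷⁻; []∉map∷; ∈-lookup)
open import Data.List.Relation.Binary.Disjoint.Propositional using (Disjoint)
open import Data.List.Relation.Unary.All as All using (All; []; _∷_)
open import Data.List.Relation.Unary.AllPairs using (AllPairs; []; _∷_)
open import Data.List.Relation.Unary.Any using (here; index)
open import Data.List.Relation.Unary.Any.Properties using (lookup-index)
open import Data.List.Relation.Unary.Unique.Propositional using (Unique)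
import Data.List.Relation.Unary.Unique.Propositional.Properties as Unique
open import Data.Nat
open import Data.Nat.Properties
open import Data.Nat.Combinatorics using (_C_; nCk+nC[k+1]≡[n+1]C[k+1]; nCk≡nC[n∸k]; nC1≡n)
open import Data.Nat.DivMod using (m*n/n≡m)
open import Data.Nat.Tactic.RingSolver using (solve-∀)
open import Data.Product using (∃; _×_; _,_)
open import Data.Sum using (inj₁; inj₂)
open import Data.Unit using (⊤; tt)
open import Function.Bundles using (_⇔_; mk⇔)
open import Relation.Binary.PropositionalEquality
  using (_≡_; refl; sym; trans; cong; cong₂; subst; ≢-sym; module ≡-Reasoning)
open import Relation.Nullary using (yes; no)
open import Defs

open CommutativeSemigroupProperties +-commutativeSemigroup
  using () renaming (interchange to +-interchange)

[k+1]*[n+1]C[k+1]≡[n+1]*nCk : ∀ n k → suc k * (suc n C suc k) ≡ suc n * (n C k)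
[k+1]*[n+1]C[k+1]≡[n+1]*nCk zero    zero    = refl
[k+1]*[n+1]C[k+1]≡[n+1]*nCk zero    (suc k) = *-zeroʳ (suc (suc k))
[k+1]*[n+1]C[k+1]≡[n+1]*nCk (suc n) zero    =
  trans (+-identityʳ _) (trans (nC1≡n (suc (suc n))) (sym (*-identityʳ _)))
[k+1]*[n+1]C[k+1]≡[n+1]*nCk (suc n) (suc k) = begin
  suc (suc k) * (suc (suc n) C suc (suc k))
    ≡⟨ cong (suc (suc k) *_) (nCk+nC[k+1]≡[n+1]C[k+1] (suc n) (suc k)) ⟨
  suc (suc k) * (a + b)
    ≡⟨ distribute k a b ⟩
  a + (suc k * a + suc (suc k) * b)
    ≡⟨ cong (a +_) (cong₂ _+_ ([k+1]*[n+1]C[k+1]≡[n+1]*nCk n k)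
                              ([k+1]*[n+1]C[k+1]≡[n+1]*nCk n (suc k))) ⟩
  a + (suc n * (n C k) + suc n * (n C suc k))
    ≡⟨ cong (a +_) (*-distribˡ-+ (suc n) (n C k) (n C suc k)) ⟨
  a + suc n * (n C k + n C suc k)
    ≡⟨ cong (λ x → a + suc n * x) (nCk+nC[k+1]≡[n+1]C[k+1] n k) ⟩
  suc (suc n) * a ∎
  where
  open ≡-Reasoning
  a = suc n C suc k
  b = suc n C suc (suc k)
  distribute : ∀ k a b → suc (suc k) * (a + b) ≡ a + (suc k * a + suc (suc k) * b)
  distribute = solve-∀

nCk≡nCm : ∀ {n} m k → n ≡ m + k → n C k ≡ n C m
nCk≡nCm m k refl = trans (nCk≡nC[n∸k] (m≤n+m k m)) (cong ((m + k) C_) (m+n∸n≡m m k))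

-- The number of weakly increasing y₀ ≤ … ≤ y_{k-1} with w ≤ y₀ and yᵢ < w + d + i (length-runs).
ballot : ℕ → ℕ → ℕ
ballot d       zero    = 1
ballot zero    (suc k) = 0
ballot (suc d) (suc k) = ballot (suc (suc d)) k + ballot d (suc k)

ballot[d,1]≡d : ∀ d → ballot d 1 ≡ d
ballot[d,1]≡d zero    = refl
ballot[d,1]≡d (suc d) = cong suc (ballot[d,1]≡d d)

ballot+[N+1]Ck≡[N+1]C[k+1] : ∀ k d {N} → N ≡ k + k + d →
                              ballot d (suc k) + suc N C k ≡ suc N C suc k
ballot+[N+1]Ck≡[N+1]C[k+1] zero    d       refl =
  trans (+-comm (ballot d 1) 1) (trans (cong suc (ballot[d,1]≡d d)) (sym (nC1≡n (suc d))))
ballot+[N+1]Ck≡[N+1]C[k+1] (suc k) zero    refl =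
  nCk≡nCm (suc (suc k)) (suc k) (cong suc (+-identityʳ (suc k + suc k)))
ballot+[N+1]Ck≡[N+1]C[k+1] (suc k) (suc d) refl = begin
  ballot (suc d) (suc (suc k)) + suc N C suc k
    ≡⟨ cong (λ n → ballot (suc d) (suc (suc k)) + n C suc k) N≡M ⟩
  (b₁ + b₂) + suc M C suc k
    ≡⟨ cong ((b₁ + b₂) +_) (nCk+nC[k+1]≡[n+1]C[k+1] M k) ⟨
  (b₁ + b₂) + (M C k + M C suc k)
    ≡⟨ +-interchange b₁ b₂ (M C k) (M C suc k) ⟩
  (b₁ + M C k) + (b₂ + M C suc k)
    ≡⟨ cong₂ _+_ (ballot+[N+1]Ck≡[N+1]C[k+1] k (suc (suc d)) refl)
                 (ballot+[N+1]Ck≡[N+1]C[k+1] (suc k) d (reassoc′ k d)) ⟩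
  M C suc k + M C suc (suc k)
    ≡⟨ nCk+nC[k+1]≡[n+1]C[k+1] M (suc k) ⟩
  suc M C suc (suc k)
    ≡⟨ cong (_C suc (suc k)) N≡M ⟨
  suc N C suc (suc k) ∎
  where
  open ≡-Reasoning
  N = suc k + suc k + suc d
  M = suc (k + k + suc (suc d))
  b₁ = ballot (suc (suc d)) (suc k)
  b₂ = ballot d (suc (suc k))
  reassoc : ∀ k d → suc k + suc k + suc d ≡ suc (k + k + suc (suc d))
  reassoc = solve-∀
  reassoc′ : ∀ k d → k + k + suc (suc d) ≡ suc k + suc k + d
  reassoc′ = solve-∀
  N≡M : suc N ≡ suc M
  N≡M = cong suc (reassoc k d)

[k+2]*ballot[1,k+1]≡[2k+2]C[k+1] : ∀ k → suc (suc k) * ballot 1 (suc k) ≡ (suc k + suc k) C suc k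
[k+2]*ballot[1,k+1]≡[2k+2]C[k+1] k = +-cancelʳ-≡ (suc (suc k) * B₀) _ _ (begin
  suc (suc k) * X + suc (suc k) * B₀  ≡⟨ *-distribˡ-+ (suc (suc k)) X B₀ ⟨
  suc (suc k) * (X + B₀)             ≡⟨ cong (suc (suc k) *_) (ballot+[N+1]Ck≡[N+1]C[k+1] k 1 N≡) ⟩
  B₁ + suc k * B₁                    ≡⟨ cong (B₁ +_) ratio ⟨
  B₁ + suc (suc k) * B₀              ∎)
  where
  open ≡-Reasoning
  N = k + suc k
  N≡ : N ≡ k + k + 1
  N≡ = trans (+-suc k k) (+-comm 1 (k + k))
  X = ballot 1 (suc k)
  B₀ = suc N C k
  B₁ = suc N C suc k
  N+1≡ : suc N ≡ suc (suc k) + k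
  N+1≡ = cong suc (+-suc k k)
  ratio : suc (suc k) * B₀ ≡ suc k * B₁
  ratio = begin
    suc (suc k) * B₀                    ≡⟨ cong (suc (suc k) *_) (nCk≡nCm (suc (suc k)) k N+1≡) ⟩
    suc (suc k) * (suc N C suc (suc k)) ≡⟨ [k+1]*[n+1]C[k+1]≡[n+1]*nCk N (suc k) ⟩
    suc N * (N C suc k)                 ≡⟨ cong (suc N *_) (nCk≡nCm k (suc k) refl) ⟩
    suc N * (N C k)                     ≡⟨ [k+1]*[n+1]C[k+1]≡[n+1]*nCk N k ⟨
    suc k * B₁                          ∎

catalan≡ballot : ∀ m → catalan m ≡ ballot 1 m
catalan≡ballot zero    = refl
catalan≡ballot (suc k) = begin
  ((suc k + suc k) C suc k) / suc (suc k)
    ≡⟨ cong (_/ suc (suc k)) ([k+2]*ballot[1,k+1]≡[2k+2]C[k+1] k) ⟨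
  (suc (suc k) * X) / suc (suc k)
    ≡⟨ cong (_/ suc (suc k)) (*-comm (suc (suc k)) X) ⟩
  (X * suc (suc k)) / suc (suc k)
    ≡⟨ m*n/n≡m X (suc (suc k)) ⟩
  X ∎
  where
  open ≡-Reasoning
  X = ballot 1 (suc k)

Bounded : ℕ → List ℕ → Set
Bounded p []      = ⊤
Bounded p (x ∷ t) = x < p × Bounded (suc p) t

bounded⇒lookup< : ∀ {p} s → Bounded p s → (i : Fin (length s)) → lookup s i < p + toℕ i
bounded⇒lookup< {p} (x ∷ t) (x<p , _) zero    = subst (x <_) (sym (+-identityʳ p)) x<p
bounded⇒lookup< {p} (x ∷ t) (_ , b)   (suc i) =
  subst (lookup t i <_) (sym (+-suc p (toℕ i))) (bounded⇒lookup< t b i)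

lookup<⇒bounded : ∀ {p} s → ((i : Fin (length s)) → lookup s i < p + toℕ i) → Bounded p s
lookup<⇒bounded     []      _ = tt
lookup<⇒bounded {p} (x ∷ t) h =
  subst (x <_) (+-identityʳ p) (h zero) ,
  lookup<⇒bounded t (λ i → subst (lookup t i <_) (+-suc p (toℕ i)) (h (suc i)))

module _ {a ℓ} {A : Set a} {R : A → A → Set ℓ} where

  AllPairs-lookup : ∀ {s} → AllPairs R s → {i j : Fin (length s)} →
                    toℕ i < toℕ j → R (lookup s i) (lookup s j)
  AllPairs-lookup (r ∷ _)  {zero}  {suc j} _         = All.lookup r (∈-lookup j)
  AllPairs-lookup (_ ∷ rs) {suc i} {suc j} (s≤s i<j) = AllPairs-lookup rs i<j

  lookup-AllPairs : ∀ s → (∀ {i j : Fin (length s)} → toℕ i < toℕ j → R (lookup s i) (lookup s j)) →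
                    AllPairs R s
  lookup-AllPairs []      _ = []
  lookup-AllPairs (x ∷ t) h =
    All.tabulate (λ x∈t → subst (R x) (sym (lookup-index x∈t)) (h {zero} {suc (index x∈t)} z<s))
    ∷ lookup-AllPairs t (λ i<j → h (s≤s i<j))

PositivesIncrease : List ℕ → Set
PositivesIncrease = AllPairs (λ x y → 0 < x → 0 < y → x ≤ y)

NoDropToZero : List ℕ → Set
NoDropToZero = AllPairs (λ x y → 0 < x → 0 < y)

ZerosBeforeDrop : List ℕ → Set
ZerosBeforeDrop s = ∀ {i j k : Fin (length s)} → toℕ i < toℕ j → toℕ j < toℕ k →
                    0 < lookup s j → lookup s k ≡ 0 → lookup s i ≡ 0

zerosBeforeDrop-tail : ∀ {x t} → ZerosBeforeDrop (x ∷ t) → ZerosBeforeDrop t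
zerosBeforeDrop-tail z i<j j<k = z (s≤s i<j) (s≤s j<k)

zerosBeforeDrop-0∷ : ∀ {t} → ZerosBeforeDrop t → ZerosBeforeDrop (0 ∷ t)
zerosBeforeDrop-0∷ z {zero}                  _         _         _ _ = refl
zerosBeforeDrop-0∷ z {suc i} {suc j} {suc k} (s≤s i<j) (s≤s j<k)     = z i<j j<k

zerosBeforeDrop⇒noDrop : ∀ {y t} → ZerosBeforeDrop (suc y ∷ t) → NoDropToZero t
zerosBeforeDrop⇒noDrop {t = t} z = lookup-AllPairs t λ {j} {k} j<k 0<tj →
  n≢0⇒n>0 (λ tk≡0 → 0≢1+n (sym (z {zero} {suc j} {suc k} z<s (s≤s j<k) 0<tj tk≡0)))

noDrop⇒zerosBeforeDrop : ∀ {x t} → NoDropToZero t → ZerosBeforeDrop (x ∷ t)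
noDrop⇒zerosBeforeDrop nd {i} {suc j} {suc k} _ (s≤s j<k) 0<tj tk≡0 =
  ⊥-elim (<-irrefl (sym tk≡0) (AllPairs-lookup nd j<k 0<tj))

invariants⇒Avoids : ∀ {s} → PositivesIncrease s → ZerosBeforeDrop s → Avoids s
invariants⇒Avoids {s} inc zbd (i , j , k , i<j , j<k , _ , sk<sj , si≢sk) with lookup s k ≟ 0
... | yes sk≡0 = si≢sk (trans (zbd i<j j<k (≤-<-trans z≤n sk<sj) sk≡0) (sym sk≡0))
... | no  sk≢0 = <⇒≱ sk<sj (AllPairs-lookup inc j<k (≤-<-trans z≤n sk<sj) (n≢0⇒n>0 sk≢0))

Avoids⇒invariants : ∀ {s} → Bounded 1 s → Avoids s → PositivesIncrease s × ZerosBeforeDrop s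
Avoids⇒invariants {[]}    _             _  = [] , λ { {()} }
Avoids⇒invariants {0 ∷ t} (s≤s z≤n , _) av = inc , zbd
  where
  e = 0 ∷ t
  positive⇒notFirst : (i : Fin (length e)) → 0 < lookup e i → 0 < toℕ i
  positive⇒notFirst (suc i) _ = z<s
  inc : PositivesIncrease e
  inc = lookup-AllPairs e λ {i} {j} i<j 0<ei 0<ej → ≮⇒≥ λ ej<ei →
    av (zero , i , j , positive⇒notFirst i 0<ei , i<j , z≤n , ej<ei , λ 0≡ej → <-irrefl 0≡ej 0<ej)
  zbd : ZerosBeforeDrop e
  zbd {i} {j} {k} i<j j<k 0<ej ek≡0 with lookup e i ≟ 0
  ... | yes ei≡0 = ei≡0
  ... | no  ei≢0 = ⊥-elim (av (i , j , k , i<j , j<k , AllPairs-lookup inc i<j (n≢0⇒n>0 ei≢0) 0<ej ,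
                               subst (_< lookup e j) (sym ek≡0) 0<ej , λ ei≡ek → ei≢0 (trans ei≡ek ek≡0)))

data Run (w p : ℕ) : List ℕ → Set where
  []   : Run w p []
  step : ∀ {y t} → w ≤ y → y < p → Run y (suc p) t → Run w p (y ∷ t)

data ZerosThenRun (v p : ℕ) : List ℕ → Set where
  run   : ∀ {s} → Run v p s → ZerosThenRun v p s
  zero∷ : ∀ {t} → ZerosThenRun v (suc p) t → ZerosThenRun v p (0 ∷ t)

data Avoider (p : ℕ) : List ℕ → Set where
  []    : Avoider p []
  zero∷ : ∀ {t} → Avoider (suc p) t → Avoider p (0 ∷ t)
  peak  : ∀ {y t} → 0 < y → y < p → ZerosThenRun y (suc p) t → Avoider p (y ∷ t)

positive⇒noDrop : ∀ {s} → All (0 <_) s → NoDropToZero s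
positive⇒noDrop []        = []
positive⇒noDrop (_ ∷ pos) = All.map (λ 0<z _ → 0<z) pos ∷ positive⇒noDrop pos

Run⇒invariants : ∀ {w p s} → 0 < w → Run w p s → Bounded p s × All (w ≤_) s × PositivesIncrease s
Run⇒invariants _   []                  = tt , [] , []
Run⇒invariants 0<w (step w≤y y<p tail) with b , ge , inc ← Run⇒invariants (<-≤-trans 0<w w≤y) tail =
  (y<p , b) , (w≤y ∷ All.map (≤-trans w≤y) ge) , (All.map (λ y≤z _ _ → y≤z) ge ∷ inc)

ZerosThenRun⇒invariants : ∀ {v p s} → 0 < v → ZerosThenRun v (suc p) s →
  Bounded (suc p) s × All (λ x → 0 < x → v ≤ x) s × PositivesIncrease s × NoDropToZero s
ZerosThenRun⇒invariants 0<v (run r) with b , ge , inc ← Run⇒invariants 0<v r =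
  b , All.map (λ v≤x _ → v≤x) ge , inc , positive⇒noDrop (All.map (<-≤-trans 0<v) ge)
ZerosThenRun⇒invariants 0<v (zero∷ z) with b , lo , inc , nd ← ZerosThenRun⇒invariants 0<v z =
  (z<s , b) , ((λ ()) ∷ lo) , (All.universal (λ _ ()) _ ∷ inc) , (All.universal (λ _ ()) _ ∷ nd)

Avoider⇒invariants : ∀ {p s} → Avoider (suc p) s →
                     Bounded (suc p) s × PositivesIncrease s × ZerosBeforeDrop s
Avoider⇒invariants []               = tt , [] , λ { {()} }
Avoider⇒invariants (zero∷ a)        with b , inc , zbd ← Avoider⇒invariants a =
  (z<s , b) , (All.universal (λ _ ()) _ ∷ inc) , zerosBeforeDrop-0∷ zbd
Avoider⇒invariants (peak 0<y y<p z) with b , lo , inc , nd ← ZerosThenRun⇒invariants 0<y z =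
  (y<p , b) , (All.map (λ y≤x _ → y≤x) lo ∷ inc) , noDrop⇒zerosBeforeDrop nd

invariants⇒Run : ∀ {w p} s → 0 < w → Bounded p s → All (w ≤_) s → PositivesIncrease s → Run w p s
invariants⇒Run []      _   _         _          _          = []
invariants⇒Run (y ∷ t) 0<w (y<p , b) (w≤y ∷ ge) (iy ∷ inc) =
  step w≤y y<p (invariants⇒Run t 0<y b ge′ inc)
  where
  0<y = <-≤-trans 0<w w≤y
  ge′ = All.zipWith (λ (y≤z , w≤z) → y≤z 0<y (<-≤-trans 0<w w≤z)) (iy , ge)

invariants⇒ZerosThenRun : ∀ {v p} s → 0 < v → Bounded p s → All (λ x → 0 < x → v ≤ x) s →
                          PositivesIncrease s → NoDropToZero s → ZerosThenRun v p s
invariants⇒ZerosThenRun []          _   _       _        _         _        = run []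
invariants⇒ZerosThenRun (zero ∷ t)  0<v (_ , b) (_ ∷ lo) (_ ∷ inc) (_ ∷ nd) =
  zero∷ (invariants⇒ZerosThenRun t 0<v b lo inc nd)
invariants⇒ZerosThenRun (suc y ∷ t) 0<v b       lo       inc       (ny ∷ _) =
  run (invariants⇒Run (suc y ∷ t) 0<v b (All.zipWith (λ (v≤ , 0<x) → v≤ 0<x) (lo , pos)) inc)
  where pos = z<s ∷ All.map (λ 0<z → 0<z z<s) ny

invariants⇒Avoider : ∀ {p} s → Bounded p s → PositivesIncrease s → ZerosBeforeDrop s → Avoider p s
invariants⇒Avoider []          _         _          _   = []
invariants⇒Avoider (zero ∷ t)  (_ , b)   (_ ∷ inc)  zbd =
  zero∷ (invariants⇒Avoider t b inc (zerosBeforeDrop-tail zbd))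
invariants⇒Avoider (suc y ∷ t) (y<p , b) (iy ∷ inc) zbd =
  peak z<s y<p (invariants⇒ZerosThenRun t z<s b (All.map (λ y≤ → y≤ z<s) iy) inc
                                          (zerosBeforeDrop⇒noDrop zbd))

slack⇒< : ∀ {y r p} → y + suc r ≡ p → y < p
slack⇒< {y} refl = m<m+n y z<s

<⇒slack : ∀ {y p} → y < p → ∃ λ r → y + suc r ≡ p
<⇒slack {y} y<p with r , eq ← m≤n⇒∃[o]m+o≡n y<p = r , trans (+-suc y r) eq

slack-suc : ∀ {y r p} → y + suc r ≡ p → y + suc (suc r) ≡ suc p
slack-suc {y} {r} eq = trans (+-suc y (suc r)) (cong suc eq)

unique-∷++ : ∀ {x} {L R : List (List ℕ)} → Unique L → Unique R → (∀ {t} → x ∷ t ∉ R) →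
             Unique (map (x ∷_) L ++ R)
unique-∷++ {x} {L} {R} uL uR x∉R = Unique.++⁺ (Unique.map⁺ ∷-injectiveʳ uL) uR disjoint
  where
  disjoint : Disjoint (map (x ∷_) L) R
  disjoint (m₁ , m₂) with _ , _ , refl ← map∷⁻ m₁ = x∉R m₂

length-∷++ : ∀ x (L R : List (List ℕ)) → length (map (x ∷_) L ++ R) ≡ length L + length R
length-∷++ x L R = trans (length-++ (map (x ∷_) L)) (cong (_+ length R) (length-map (x ∷_) L))

-- heads f w d lists the y ∷ t with w ≤ y < w + d and t ∈ f y (w + d ∸ y).
heads : (ℕ → ℕ → List (List ℕ)) → ℕ → ℕ → List (List ℕ)
heads f w zero    = []
heads f w (suc d) = map (w ∷_) (f w (suc d)) ++ heads f (suc w) d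

module _ (f : ℕ → ℕ → List (List ℕ)) where

  []∉heads : ∀ w d → [] ∉ heads f w d
  []∉heads w (suc d) m with ∈-++⁻ (map (w ∷_) (f w (suc d))) m
  ... | inj₁ m₁ = []∉map∷ m₁
  ... | inj₂ m₂ = []∉heads (suc w) d m₂

  ∈-heads⁻ : ∀ w d {y t} → y ∷ t ∈ heads f w d →
             w ≤ y × ∃ λ r → y + suc r ≡ w + d × t ∈ f y (suc r)
  ∈-heads⁻ w (suc d) m with ∈-++⁻ (map (w ∷_) (f w (suc d))) m
  ... | inj₁ m₁ with refl , t∈ ← map∷-decomp∈ m₁ = ≤-refl , d , refl , t∈
  ... | inj₂ m₂ with w<y , r , eq , t∈ ← ∈-heads⁻ (suc w) d m₂ =
    <⇒≤ w<y , r , trans eq (sym (+-suc w d)) , t∈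

  ∈-heads⁺ : ∀ w d {y r t} → w ≤ y → y + suc r ≡ w + d → t ∈ f y (suc r) →
             y ∷ t ∈ heads f w d
  ∈-heads⁺ w zero    w≤y eq _ = ⊥-elim (<⇒≱ (slack⇒< (trans eq (+-identityʳ w))) w≤y)
  ∈-heads⁺ w (suc d) {y} w≤y eq t∈ with y ≟ w
  ... | yes refl with refl ← suc-injective (+-cancelˡ-≡ w _ _ eq) = ∈-++⁺ˡ (∈-map⁺ (w ∷_) t∈)
  ... | no  y≢w = ∈-++⁺ʳ (map (w ∷_) (f w (suc d)))
                    (∈-heads⁺ (suc w) d (≤∧≢⇒< w≤y (≢-sym y≢w)) (trans eq (+-suc w d)) t∈)

  ∉-heads : ∀ w d {y t} → y < w → y ∷ t ∉ heads f w d
  ∉-heads w d y<w m with w≤y , _ ← ∈-heads⁻ w d m = <⇒≱ y<w w≤y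

  unique-heads : ∀ w d → (∀ {y} r → w ≤ y → Unique (f y r)) → Unique (heads f w d)
  unique-heads w zero    _ = []
  unique-heads w (suc d) u =
    unique-∷++ (u (suc d) ≤-refl) (unique-heads (suc w) d (λ r w<y → u r (<⇒≤ w<y)))
               (∉-heads (suc w) d ≤-refl)

runs : ℕ → ℕ → ℕ → List (List ℕ)
runs w d zero    = [ [] ]
runs w d (suc k) = heads (λ y r → runs y (suc r) k) w d

zerosThenRuns : ℕ → ℕ → ℕ → List (List ℕ)
zerosThenRuns v d zero    = [ [] ]
zerosThenRuns v d (suc k) = map (0 ∷_) (zerosThenRuns v (suc d) k) ++ runs v d (suc k)

peaks : ℕ → ℕ → ℕ → List (List ℕ)
peaks w d k = heads (λ y r → zerosThenRuns y (suc r) k) w d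

avoiders : ℕ → ℕ → List (List ℕ)
avoiders q zero    = [ [] ]
avoiders q (suc k) = map (0 ∷_) (avoiders (suc q) k) ++ peaks 1 q k

∈-runs⁻ : ∀ w d k {s} → s ∈ runs w d k → length s ≡ k × Run w (w + d) s
∈-runs⁻ w d zero    (here refl) = refl , []
∈-runs⁻ w d (suc k) {[]}    m   = ⊥-elim ([]∉heads _ w d m)
∈-runs⁻ w d (suc k) {y ∷ t} m
  with w≤y , r , eq , t∈ ← ∈-heads⁻ _ w d m
  with len , tail ← ∈-runs⁻ y (suc (suc r)) k t∈
  = cong suc len , step w≤y (slack⇒< eq) (subst (λ p → Run y p t) (slack-suc eq) tail)

∈-runs⁺ : ∀ w d {s} → Run w (w + d) s → s ∈ runs w d (length s)
∈-runs⁺ w d []                          = here refl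
∈-runs⁺ w d (step {y} {t} w≤y y<p tail) with r , eq ← <⇒slack y<p =
  ∈-heads⁺ _ w d w≤y eq (∈-runs⁺ y (suc (suc r)) (subst (λ p → Run y p t) (sym (slack-suc eq)) tail))

∈-zerosThenRuns⁻ : ∀ v d k {s} → s ∈ zerosThenRuns v d k → length s ≡ k × ZerosThenRun v (v + d) s
∈-zerosThenRuns⁻ v d zero    (here refl) = refl , run []
∈-zerosThenRuns⁻ v d (suc k) m with ∈-++⁻ (map (0 ∷_) (zerosThenRuns v (suc d) k)) m
... | inj₂ m₂ with len , r ← ∈-runs⁻ v d (suc k) m₂ = len , run r
... | inj₁ m₁ with t , t∈ , refl ← map∷⁻ m₁ with len , z ← ∈-zerosThenRuns⁻ v (suc d) k t∈ =
  cong suc len , zero∷ (subst (λ p → ZerosThenRun v p t) (+-suc v d) z)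

∈-zerosThenRuns⁺ : ∀ v d {s} → ZerosThenRun v (v + d) s → s ∈ zerosThenRuns v d (length s)
∈-zerosThenRuns⁺ v d (run [])             = here refl
∈-zerosThenRuns⁺ v d (run r@(step _ _ _)) = ∈-++⁺ʳ (map (0 ∷_) _) (∈-runs⁺ v d r)
∈-zerosThenRuns⁺ v d (zero∷ {t} z)        = ∈-++⁺ˡ (∈-map⁺ (0 ∷_)
  (∈-zerosThenRuns⁺ v (suc d) (subst (λ p → ZerosThenRun v p t) (sym (+-suc v d)) z)))

∈-avoiders⁻ : ∀ q k {s} → s ∈ avoiders q k → length s ≡ k × Avoider (suc q) s
∈-avoiders⁻ q zero    (here refl) = refl , []
∈-avoiders⁻ q (suc k) m with ∈-++⁻ (map (0 ∷_) (avoiders (suc q) k)) m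
... | inj₁ m₁ with t , t∈ , refl ← map∷⁻ m₁ with len , a ← ∈-avoiders⁻ (suc q) k t∈ =
  cong suc len , zero∷ a
∈-avoiders⁻ q (suc k) {[]}    m | inj₂ m₂ = ⊥-elim ([]∉heads _ 1 q m₂)
∈-avoiders⁻ q (suc k) {y ∷ t} m | inj₂ m₂
  with 0<y , r , eq , t∈ ← ∈-heads⁻ _ 1 q m₂
  with len , z ← ∈-zerosThenRuns⁻ y (suc (suc r)) k t∈
  = cong suc len , peak 0<y (slack⇒< eq) (subst (λ p → ZerosThenRun y p t) (slack-suc eq) z)

∈-avoiders⁺ : ∀ q {s} → Avoider (suc q) s → s ∈ avoiders q (length s)
∈-avoiders⁺ q []                       = here refl
∈-avoiders⁺ q (zero∷ a)                = ∈-++⁺ˡ (∈-map⁺ (0 ∷_) (∈-avoiders⁺ (suc q) a))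
∈-avoiders⁺ q (peak {y} {t} 0<y y<p z) with r , eq ← <⇒slack y<p =
  ∈-++⁺ʳ (map (0 ∷_) _) (∈-heads⁺ _ 1 q 0<y eq
    (∈-zerosThenRuns⁺ y (suc (suc r)) (subst (λ p → ZerosThenRun y p t) (sym (slack-suc eq)) z)))

unique-runs : ∀ w d k → Unique (runs w d k)
unique-runs w d zero    = [] ∷ []
unique-runs w d (suc k) = unique-heads _ w d (λ r _ → unique-runs _ (suc r) k)

unique-zerosThenRuns : ∀ {v} d k → 0 < v → Unique (zerosThenRuns v d k)
unique-zerosThenRuns     d zero    _   = [] ∷ []
unique-zerosThenRuns {v} d (suc k) 0<v =
  unique-∷++ (unique-zerosThenRuns (suc d) k 0<v) (unique-runs v d (suc k)) (∉-heads _ v d 0<v)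

unique-avoiders : ∀ q k → Unique (avoiders q k)
unique-avoiders q zero    = [] ∷ []
unique-avoiders q (suc k) =
  unique-∷++ (unique-avoiders (suc q) k)
             (unique-heads _ 1 q (λ r 0<y → unique-zerosThenRuns (suc r) k 0<y))
             (∉-heads _ 1 q z<s)

length-runs : ∀ k w d → length (runs w d k) ≡ ballot d k
length-runs zero    w d       = refl
length-runs (suc k) w zero    = refl
length-runs (suc k) w (suc d) =
  trans (length-∷++ w (runs w (suc (suc d)) k) (runs (suc w) d (suc k)))
        (cong₂ _+_ (length-runs k w (suc (suc d))) (length-runs (suc k) (suc w) d))

length-zerosThenRuns : ∀ k v d → length (zerosThenRuns v d k) ≡ ballot (suc d) k
length-zerosThenRuns zero    v d = refl
length-zerosThenRuns (suc k) v d =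
  trans (length-∷++ 0 (zerosThenRuns v (suc d) k) (runs v d (suc k)))
        (cong₂ _+_ (length-zerosThenRuns k v (suc d)) (length-runs (suc k) v d))

length-peaks+ballot : ∀ k w d → length (peaks w d k) + ballot 1 (suc k) ≡ ballot (suc d) (suc k)
length-peaks+ballot k w zero    = refl
length-peaks+ballot k w (suc d) = begin
  length (map (w ∷_) Z ++ H) + ballot 1 (suc k) ≡⟨ cong (_+ ballot 1 (suc k)) (length-∷++ w Z H) ⟩
  length Z + length H + ballot 1 (suc k)       ≡⟨ +-assoc (length Z) (length H) (ballot 1 (suc k)) ⟩
  length Z + (length H + ballot 1 (suc k))     ≡⟨ cong₂ _+_ (length-zerosThenRuns k w (suc (suc d)))
                                                            (length-peaks+ballot k (suc w) d) ⟩
  ballot (suc (suc d)) (suc k)                 ∎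
  where
  open ≡-Reasoning
  Z = zerosThenRuns w (suc (suc d)) k
  H = peaks (suc w) d k

length-avoiders+catalanSum : ∀ k q → length (avoiders q k) + catalanSum k ≡ ballot (suc (suc q)) k
length-avoiders+catalanSum zero    q = refl
length-avoiders+catalanSum (suc k) q = begin
  length (map (0 ∷_) A ++ P) + (catalanSum k + catalan (suc k))
    ≡⟨ cong₂ _+_ (length-∷++ 0 A P) (cong (catalanSum k +_) (catalan≡ballot (suc k))) ⟩
  (length A + length P) + (catalanSum k + ballot 1 (suc k))
    ≡⟨ +-interchange (length A) (length P) (catalanSum k) (ballot 1 (suc k)) ⟩
  (length A + catalanSum k) + (length P + ballot 1 (suc k))
    ≡⟨ cong₂ _+_ (length-avoiders+catalanSum k (suc q)) (length-peaks+ballot k 1 q) ⟩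
  ballot (suc (suc q)) (suc k) ∎
  where
  open ≡-Reasoning
  A = avoiders (suc q) k
  P = peaks 1 q k

length-avoiders : ∀ n → length (avoiders 0 n) ≡ catalan (suc n) ∸ catalanSum n
length-avoiders n = begin
  length A                               ≡⟨ m+n∸n≡m (length A) (catalanSum n) ⟨
  length A + catalanSum n ∸ catalanSum n ≡⟨ cong (_∸ catalanSum n) (length-avoiders+catalanSum n 0) ⟩
  ballot 2 n ∸ catalanSum n              ≡⟨ cong (_∸ catalanSum n) catalan[n+1]≡ballot[2,n] ⟨
  catalan (suc n) ∸ catalanSum n         ∎
  where
  open ≡-Reasoning
  A = avoiders 0 n
  catalan[n+1]≡ballot[2,n] : catalan (suc n) ≡ ballot 2 n
  catalan[n+1]≡ballot[2,n] = trans (catalan≡ballot (suc n)) (+-identityʳ (ballot 2 n))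

mainTheorem19 : (n : ℕ) → n ≥ 1 →
    ∃ λ (L : List (List ℕ)) → Unique L ×
      ((e : List ℕ) → (e ∈ L) ⇔ (IsInversionSeq n e × Avoids e)) ×
      (length L ≡ catalan (suc n) ∸ catalanSum n)
mainTheorem19 n _ =
  avoiders 0 n , unique-avoiders 0 n , (λ e → mk⇔ (sound e) (complete e)) , length-avoiders n
  where
  sound : ∀ e → e ∈ avoiders 0 n → IsInversionSeq n e × Avoids e
  sound e e∈ with len , a ← ∈-avoiders⁻ 0 n e∈ with b , inc , zbd ← Avoider⇒invariants a =
    (len , bounded⇒lookup< e b) , invariants⇒Avoids inc zbd
  complete : ∀ e → IsInversionSeq n e × Avoids e → e ∈ avoiders 0 n
  complete e ((len , e<) , av) =
    let b = lookup<⇒bounded e e<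
        inc , zbd = Avoids⇒invariants b av
    in subst (λ k → e ∈ avoiders 0 k) len (∈-avoiders⁺ 0 (invariants⇒Avoider e b inc zbd))
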